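{- Let $v\in S_n$ and let $i$ be the last ascent of $v$ (the largest $i$ with $v(i)<v(i+1)$). Then $D(v)$ and $D(vs_i)$ agree in all columns other than $i$ and $i+1$. Moreover, $D(vs_i)$ is obtained from $D(v)$ by moving every box of $D(v)$ in column $i$ lying strictly above row $n-v(i+1)+1$ one box to the right (into column $i+1$), and deleting the box at position $(n-v(i+1)+1,i)$, which necessarily lies in $D(v)$.
   Context: Positions $(i,j)$ in the $n\times n$ grid mean row $i$ counted from the bottom, column $j$ from the left; "above" means larger row index. The Rothe diagram of $u\in S_n$ is $D(u)=\{(a,b): a<n-u(b)+1,\ b<u^{ -1}(n-a+1)\}$. $s_i=(i\leftrightarrow i+1)$ and $vs_i$ is the composition (swapping the values in positions $i,i+1$). -}

module Defs where

open import Data.Nat using (ℕ; suc; _+_; _∸_; _<_)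
open import Data.Fin using (Fin; toℕ; opposite)
open import Data.Fin.Permutation using (Permutation′; _⟨$⟩ʳ_; _⟨$⟩ˡ_; transpose; _∘ₚ_)
open import Data.Product using (_×_)
open import Relation.Binary.PropositionalEquality using (_≡_)
open import Relation.Nullary using (¬_)

-- Conventions: a permutation u ∈ S_n is a 'Permutation′ n' on Fin n = {0,…,n-1};
-- the paper's 1-based position/value k corresponds to the Fin element k-1.

pos : ∀ {n} → Fin n → ℕ
pos k = suc (toℕ k)

val : ∀ {n} → Permutation′ n → Fin n → ℕ
val u b = pos (u ⟨$⟩ʳ b)

-- u⁻¹(n - a + 1) for row pos a: the value n - pos a + 1 is the Fin element
-- n - pos a = opposite a; returns the 1-based position.
invAt : ∀ {n} → Permutation′ n → Fin n → ℕ
invAt u a = pos (u ⟨$⟩ˡ opposite a)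

-- Rothe diagram: (a , b) ∈ D(u) iff  a < n - u(b) + 1  and  b < u⁻¹(n - a + 1)
-- (rows counted from the bottom, columns from the left, both 1-based)
D : ∀ {n} → Permutation′ n → Fin n → Fin n → Set
D {n} u a b = (pos a < n ∸ val u b + 1) × (pos b < invAt u a)

-- v s_i : position b ↦ v(s_i(b)); '_∘ₚ_' applies its left argument first.
_·s[_,_] : ∀ {n} → Permutation′ n → Fin n → Fin n → Permutation′ n
v ·s[ i , i′ ] = transpose i i′ ∘ₚ v

IsLastAscent : ∀ {n} → Permutation′ n → Fin n → Fin n → Set
IsLastAscent v i i′ =
  (pos i′ ≡ suc (pos i)) × (val v i < val v i′) ×
  (∀ (j j′ : Fin _) → pos j′ ≡ suc (pos j) → pos i < pos j → ¬ (val v j < val v j′))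

-- Since i is the last ascent of v, v is strictly decreasing from position i + 1 on; hence
-- every value right of position i + 1 is below v(i + 1), and every value at a position ≥ i
-- is at most v(i + 1). Index rows by the value k = n - a, so that (k , b) ∈ D(u) iff
-- u(b) < k and b < u⁻¹(k). Swapping the adjacent positions i, i + 1 leaves the values in the
-- other columns alone and, for b ≠ i, does not affect the comparison b < u⁻¹(k). So column
-- i of D(v s_i) needs some k > v(i + 1) with v⁻¹(k) ≥ i, which the monotonicity rules out,
-- and column i + 1 of D(v s_i) consists of the k > v(i) with v⁻¹(k) > i + 1, i.e. of the
-- boxes of column i of D(v) with k < v(i + 1). The box (v(i + 1) , i) is the removed one.

module Submission where

open import Defs
open import Data.Nat using (ℕ; suc; _+_; _∸_; _<_; _≤_; _≥_; s≤s; s≤s⁻¹)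
open import Data.Nat.Properties hiding (_≟_)
open import Data.Fin using (Fin; toℕ; opposite; fromℕ<; _≟_)
open import Data.Fin.Properties using (toℕ-injective; toℕ<n; toℕ-fromℕ<; opposite-prop; opposite-involutive)
open import Data.Fin.Permutation using (Permutation′; _⟨$⟩ʳ_; _⟨$⟩ˡ_; inverseʳ; inverseˡ)
import Data.Fin.Permutation.Components as PC
open import Data.Product using (_×_; ∃; _,_; proj₁; proj₂)
open import Data.Product.Function.NonDependent.Propositional using (_×-⇔_)
open import Data.Sum using (_⊎_; inj₁; inj₂)
open import Data.Sum.Function.Propositional using (_⊎-⇔_)
open import Data.Empty using (⊥-elim)
open import Relation.Binary.PropositionalEquality using (_≡_; _≢_; refl; sym; trans; cong; subst)
open import Relation.Nullary using (¬_; Dec; yes; no)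
open import Relation.Binary.Definitions using (tri<; tri≈; tri>)
open import Function.Base using (_∘_)
open import Function.Bundles using (_⇔_; mk⇔; Equivalence; Injection)
import Function.Properties.Equivalence as ⇔
open import Function.Properties.Inverse using (↔⇒↣)
open import Function.Related.TypeIsomorphisms using (¬-cong-⇔)

open Equivalence using (to; from)

transpose-matchˡ : ∀ {n} (i j : Fin n) → PC.transpose i j i ≡ j
transpose-matchˡ i j with i ≟ i
... | yes _  = refl
... | no i≢i = ⊥-elim (i≢i refl)

transpose-matchʳ : ∀ {n} (i j : Fin n) → PC.transpose i j j ≡ i
transpose-matchʳ i j with j ≟ i
... | yes j≡i = j≡i
... | no _ with j ≟ j
...   | yes _  = refl
...   | no j≢j = ⊥-elim (j≢j refl)

transpose-mismatch : ∀ {n} (i j k : Fin n) → k ≢ i → k ≢ j → PC.transpose i j k ≡ k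
transpose-mismatch i j k k≢i k≢j with k ≟ i
... | yes k≡i = ⊥-elim (k≢i k≡i)
... | no _ with k ≟ j
...   | yes k≡j = ⊥-elim (k≢j k≡j)
...   | no _    = refl

module AdjacentTransposition {n} {j j′ : Fin n} (j′≡1+j : toℕ j′ ≡ suc (toℕ j)) where

  <-j′⇔<-j : ∀ {b} → b ≢ j → toℕ b < toℕ j′ ⇔ toℕ b < toℕ j
  <-j′⇔<-j {b} b≢j = mk⇔
    (λ b<j′ → ≤∧≢⇒< (s≤s⁻¹ (subst (toℕ b <_) j′≡1+j b<j′)) (b≢j ∘ toℕ-injective))
    (λ b<j → subst (toℕ b <_) (sym j′≡1+j) (m<n⇒m<1+n b<j))

  <-transpose : ∀ {b} p → b ≢ j → toℕ b < toℕ (PC.transpose j′ j p) ⇔ toℕ b < toℕ p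
  <-transpose {b} p b≢j = by-cases (p ≟ j′) (p ≟ j)
    where
    by-cases : Dec (p ≡ j′) → Dec (p ≡ j) → toℕ b < toℕ (PC.transpose j′ j p) ⇔ toℕ b < toℕ p
    by-cases (yes refl) _ rewrite transpose-matchˡ j′ j = ⇔.sym (<-j′⇔<-j b≢j)
    by-cases (no _) (yes refl) rewrite transpose-matchʳ j′ j = <-j′⇔<-j b≢j
    by-cases (no p≢j′) (no p≢j) rewrite transpose-mismatch j′ j p p≢j′ p≢j = ⇔.refl

  <-transpose⇒≤ : ∀ p → toℕ j < toℕ (PC.transpose j′ j p) → toℕ j ≤ toℕ p
  <-transpose⇒≤ p = by-cases (p ≟ j′) (p ≟ j)
    where
    by-cases : Dec (p ≡ j′) → Dec (p ≡ j) → toℕ j < toℕ (PC.transpose j′ j p) → toℕ j ≤ toℕ p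
    by-cases (yes refl) _ rewrite transpose-matchˡ j′ j = ⊥-elim ∘ <-irrefl refl
    by-cases (no _) (yes refl) _ = ≤-refl
    by-cases (no p≢j′) (no p≢j) rewrite transpose-mismatch j′ j p p≢j′ p≢j = <⇒≤

descending-tail : ∀ {n} (f : Fin n → ℕ) (m : Fin n) →
  (∀ j j′ → toℕ j′ ≡ suc (toℕ j) → toℕ m ≤ toℕ j → f j′ < f j) →
  ∀ p → toℕ m < toℕ p → f p < f m
descending-tail {n} f m descent p = go (toℕ p) p refl
  where
  go : ∀ k (p : Fin n) → toℕ p ≡ k → toℕ m < k → f p < f m
  go (suc k) p p≡1+k (s≤s m≤k) with m≤n⇒m<n∨m≡n m≤k
  ... | inj₂ refl = descent m p p≡1+k ≤-refl
  ... | inj₁ m<k  = <-trans (descent q p (trans p≡1+k (cong suc (sym q≡k))) (subst (toℕ m ≤_) (sym q≡k) m≤k))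
                            (go k q q≡k m<k)
    where
    k<n : k < n
    k<n = <⇒≤ (subst (_< n) p≡1+k (toℕ<n p))
    q : Fin n
    q = fromℕ< k<n
    q≡k : toℕ q ≡ k
    q≡k = toℕ-fromℕ< k<n

≤-∸-suc-swap : ∀ {n x y} → y < n → x ≤ n ∸ suc y → y ≤ n ∸ suc x
≤-∸-suc-swap {n} {x} {y} y<n x≤ = m+n≤o⇒m≤o∸n y
  (subst (_≤ n) (trans (+-comm x (suc y)) (sym (+-suc y x))) (m≤o∸n⇒m+n≤o x y<n x≤))

<-∸-suc-swap : ∀ {n x y} → y < n → x < n ∸ suc y → y < n ∸ suc x
<-∸-suc-swap {n} {x} {y} y<n x< = m+n≤o⇒m≤o∸n (suc y)
  (subst (_≤ n) (+-comm (suc x) (suc y)) (m≤o∸n⇒m+n≤o (suc x) y<n x<))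

module _ {n} (a y : Fin n) where

  pos<⇔opposite> : pos a < n ∸ pos y + 1 ⇔ toℕ y < toℕ (opposite a)
  pos<⇔opposite> rewrite opposite-prop a | +-comm (n ∸ pos y) 1 = mk⇔
    (λ a< → <-∸-suc-swap (toℕ<n y) (s≤s⁻¹ a<))
    (λ y< → s≤s (<-∸-suc-swap (toℕ<n a) y<))

  pos≥⇔opposite≤ : pos a ≥ n ∸ pos y + 1 ⇔ toℕ (opposite a) ≤ toℕ y
  pos≥⇔opposite≤ = mk⇔
    (λ a≥ → ≮⇒≥ (≤⇒≯ a≥ ∘ from pos<⇔opposite>))
    (λ o≤ → ≮⇒≥ (≤⇒≯ o≤ ∘ to pos<⇔opposite>))

  pos>⇔opposite< : n ∸ pos y + 1 < pos a ⇔ toℕ (opposite a) < toℕ y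
  pos>⇔opposite< rewrite opposite-prop a | +-comm (n ∸ pos y) 1 = mk⇔
    (λ a> → ≰⇒> (<⇒≱ (s≤s⁻¹ a>) ∘ ≤-∸-suc-swap (toℕ<n a)))
    (λ o< → s≤s (≰⇒> (<⇒≱ o< ∘ ≤-∸-suc-swap (toℕ<n y))))

Dᵥ : ∀ {n} → Permutation′ n → Fin n → Fin n → Set
Dᵥ u k b = toℕ (u ⟨$⟩ʳ b) < toℕ k × toℕ b < toℕ (u ⟨$⟩ˡ k)

D⇔Dᵥ : ∀ {n} (u : Permutation′ n) a b → D u a b ⇔ Dᵥ u (opposite a) b
D⇔Dᵥ u a b = pos<⇔opposite> a (u ⟨$⟩ʳ b) ×-⇔ mk⇔ s≤s⁻¹ s≤s

module LastAscent {n} (v : Permutation′ n) (i i′ : Fin n) (last-ascent : IsLastAscent v i i′) where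

  w : Permutation′ n
  w = v ·s[ i , i′ ]

  vᵢ′ : ℕ
  vᵢ′ = toℕ (v ⟨$⟩ʳ i′)

  i′≡1+i : toℕ i′ ≡ suc (toℕ i)
  i′≡1+i = suc-injective (proj₁ last-ascent)

  open AdjacentTransposition i′≡1+i

  i<i′ : toℕ i < toℕ i′
  i<i′ = subst (toℕ i <_) (sym i′≡1+i) ≤-refl

  i≢i′ : i ≢ i′
  i≢i′ i≡i′ = <-irrefl (cong toℕ i≡i′) i<i′

  ascent : toℕ (v ⟨$⟩ʳ i) < vᵢ′
  ascent = s≤s⁻¹ (proj₁ (proj₂ last-ascent))

  v-injective : ∀ {p q} → toℕ (v ⟨$⟩ʳ p) ≡ toℕ (v ⟨$⟩ʳ q) → p ≡ q
  v-injective = Injection.injective (↔⇒↣ v) ∘ toℕ-injective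

  descent-after-i : ∀ j j′ → toℕ j′ ≡ suc (toℕ j) → toℕ i′ ≤ toℕ j →
                    toℕ (v ⟨$⟩ʳ j′) < toℕ (v ⟨$⟩ʳ j)
  descent-after-i j j′ j′≡1+j i′≤j = ≤∧≢⇒<
    (s≤s⁻¹ (≮⇒≥ (proj₂ (proj₂ last-ascent) j j′ (cong suc j′≡1+j) (s≤s i<j))))
    (λ vj′≡vj → 1+n≢n (trans (sym j′≡1+j) (cong toℕ (v-injective vj′≡vj))))
    where
    i<j : toℕ i < toℕ j
    i<j = subst (_≤ toℕ j) i′≡1+i i′≤j

  value-at : ∀ k {p} → v ⟨$⟩ˡ k ≡ p → toℕ (v ⟨$⟩ʳ p) ≡ toℕ k
  value-at k refl = cong toℕ (inverseʳ v)

  <-right-of-i′ : ∀ k → toℕ i′ < toℕ (v ⟨$⟩ˡ k) → toℕ k < vᵢ′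
  <-right-of-i′ k i′<p = subst (_< vᵢ′) (value-at k refl)
    (descending-tail (λ p → toℕ (v ⟨$⟩ʳ p)) i′ descent-after-i (v ⟨$⟩ˡ k) i′<p)

  ≤-from-i : ∀ k → toℕ i ≤ toℕ (v ⟨$⟩ˡ k) → toℕ k ≤ vᵢ′
  ≤-from-i k i≤p with <-cmp (toℕ i′) (toℕ (v ⟨$⟩ˡ k))
  ... | tri< i′<p _ _ = <⇒≤ (<-right-of-i′ k i′<p)
  ... | tri≈ _ i′≡p _ = ≤-reflexive (sym (value-at k (toℕ-injective (sym i′≡p))))
  ... | tri> _ _ p<i′ = <⇒≤ (subst (_< vᵢ′) (value-at k p≡i) ascent)
    where
    p≡i : v ⟨$⟩ˡ k ≡ i
    p≡i = toℕ-injective (≤-antisym (s≤s⁻¹ (subst (_ <_) i′≡1+i p<i′)) i≤p)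

  column-other : ∀ k {b} → b ≢ i → b ≢ i′ → Dᵥ w k b ⇔ Dᵥ v k b
  column-other k {b} b≢i b≢i′ rewrite transpose-mismatch i i′ b b≢i b≢i′ =
    ⇔.refl ×-⇔ <-transpose (v ⟨$⟩ˡ k) b≢i

  i′<⇔ : ∀ k → toℕ i′ < toℕ (v ⟨$⟩ˡ k) ⇔ (toℕ i < toℕ (v ⟨$⟩ˡ k) × toℕ k < vᵢ′)
  i′<⇔ k = mk⇔
    (λ i′<p → <-trans i<i′ i′<p , <-right-of-i′ k i′<p)
    (λ (i<p , k<vᵢ′) → ≤∧≢⇒< (subst (_≤ _) (sym i′≡1+i) i<p)
      (λ i′≡p → <-irrefl (sym (value-at k (toℕ-injective (sym i′≡p)))) k<vᵢ′))

  column-i′ : ∀ k → Dᵥ w k i′ ⇔ (Dᵥ v k i × toℕ k < vᵢ′)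
  column-i′ k rewrite transpose-matchʳ i i′ = mk⇔
    (λ (vᵢ<k , i′<τp) → let (i<p , k<vᵢ′) = to (i′<⇔ k) (to (<-transpose _ (i≢i′ ∘ sym)) i′<τp)
                        in (vᵢ<k , i<p) , k<vᵢ′)
    (λ ((vᵢ<k , i<p) , k<vᵢ′) → vᵢ<k , from (<-transpose _ (i≢i′ ∘ sym)) (from (i′<⇔ k) (i<p , k<vᵢ′)))

  column-i-empty : ∀ k → ¬ Dᵥ w k i
  column-i-empty k (vᵢ′<k , i<τp) rewrite transpose-matchˡ i i′ =
    <⇒≱ vᵢ′<k (≤-from-i k (<-transpose⇒≤ _ i<τp))

  column-i-bounded : ∀ k → Dᵥ v k i → toℕ k ≤ vᵢ′
  column-i-bounded k (_ , i<p) = ≤-from-i k (<⇒≤ i<p)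

  column-i′-empty : ∀ k → ¬ Dᵥ v k i′
  column-i′-empty k (vᵢ′<k , i′<p) = <-asym vᵢ′<k (<-right-of-i′ k i′<p)

  Dᵥ-after-swap : ∀ k b → Dᵥ w k b ⇔
    ((Dᵥ v k b × ¬ (b ≡ i × toℕ k ≤ vᵢ′)) ⊎ (b ≡ i′ × Dᵥ v k i × toℕ k < vᵢ′))
  Dᵥ-after-swap k b = by-cases (b ≟ i) (b ≟ i′)
    where
    by-cases : Dec (b ≡ i) → Dec (b ≡ i′) → Dᵥ w k b ⇔
      ((Dᵥ v k b × ¬ (b ≡ i × toℕ k ≤ vᵢ′)) ⊎ (b ≡ i′ × Dᵥ v k i × toℕ k < vᵢ′))
    by-cases (yes refl) _ = mk⇔ (⊥-elim ∘ column-i-empty k) λ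
      { (inj₁ (d , not-low)) → ⊥-elim (not-low (refl , column-i-bounded k d))
      ; (inj₂ (i≡i′ , _))    → ⊥-elim (i≢i′ i≡i′) }
    by-cases (no _) (yes refl) = mk⇔ (λ d → inj₂ (refl , to (column-i′ k) d)) λ
      { (inj₁ (d , _))  → ⊥-elim (column-i′-empty k d)
      ; (inj₂ (_ , d)) → from (column-i′ k) d }
    by-cases (no b≢i) (no b≢i′) = mk⇔ (λ d → inj₁ (to (column-other k b≢i b≢i′) d , b≢i ∘ proj₁)) λ
      { (inj₁ (d , _))      → from (column-other k b≢i b≢i′) d
      ; (inj₂ (b≡i′ , _)) → ⊥-elim (b≢i′ b≡i′) }

  ascent-box : Dᵥ v (v ⟨$⟩ʳ i′) i
  ascent-box = ascent , subst (toℕ i <_) (cong toℕ (sym (inverseˡ v))) i<i′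

lemma6p5 : ∀ (n : ℕ) (v : Permutation′ n) (i i′ : Fin n) →
    IsLastAscent v i i′ →
    (∀ (a b : Fin n) → b ≢ i → b ≢ i′ → (D v a b ⇔ D (v ·s[ i , i′ ]) a b)) ×
    (∀ (a b : Fin n) → D (v ·s[ i , i′ ]) a b ⇔
      ((D v a b × ¬ (b ≡ i × pos a ≥ n ∸ val v i′ + 1))
        ⊎ (b ≡ i′ × D v a i × n ∸ val v i′ + 1 < pos a))) ×
    ∃ (λ (r : Fin n) → pos r ≡ n ∸ val v i′ + 1 × D v r i)
lemma6p5 n v i i′ last-ascent = other-columns , after-swap , (r , pos-r , box-r)
  where
  open LastAscent v i i′ last-ascent

  other-columns : ∀ a b → b ≢ i → b ≢ i′ → D v a b ⇔ D w a b
  other-columns a b b≢i b≢i′ =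
    ⇔.trans (D⇔Dᵥ v a b) (⇔.trans (⇔.sym (column-other (opposite a) b≢i b≢i′)) (⇔.sym (D⇔Dᵥ w a b)))

  after-swap : ∀ a b → D w a b ⇔ ((D v a b × ¬ (b ≡ i × pos a ≥ n ∸ val v i′ + 1))
                                  ⊎ (b ≡ i′ × D v a i × n ∸ val v i′ + 1 < pos a))
  after-swap a b = ⇔.trans (D⇔Dᵥ w a b) (⇔.trans (Dᵥ-after-swap (opposite a) b) (⇔.sym
    ((D⇔Dᵥ v a b ×-⇔ ¬-cong-⇔ (⇔.refl ×-⇔ pos≥⇔opposite≤ a (v ⟨$⟩ʳ i′)))
      ⊎-⇔ (⇔.refl ×-⇔ D⇔Dᵥ v a i ×-⇔ pos>⇔opposite< a (v ⟨$⟩ʳ i′)))))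

  r : Fin n
  r = opposite (v ⟨$⟩ʳ i′)

  pos-r : pos r ≡ n ∸ val v i′ + 1
  pos-r = trans (cong suc (opposite-prop (v ⟨$⟩ʳ i′))) (+-comm 1 _)

  box-r : D v r i
  box-r = from (D⇔Dᵥ v r i) (subst (λ k → Dᵥ v k i) (sym (opposite-involutive _)) ascent-box)
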